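{- Let $q$ be a prime and $y$ an integer that is not a multiple of $q$. Then $w_{n}^{(r)}(y)\equiv0\pmod{q}$ for every integer $n\geq1$ and every positive integer $r$ with $r\equiv0\pmod{q}$.
   Context: $w_{n}^{(r)}(y)=\sum_{k=0}^{n}\left\{{n\atop k}\right\}(r)_{k}\,y^{k}$, where $\left\{{n\atop k}\right\}$ are Stirling numbers of the second kind and $(x)_{k}=x(x+1)\cdots(x+k-1)$, $(x)_0=1$. -}

module Defs where

open import Data.Nat using (ℕ; zero; suc)
import Data.Nat as ℕ
open import Data.Integer using (ℤ; +_; _+_; _*_; _^_)

stirling2 : ℕ → ℕ → ℕ
stirling2 zero    zero    = 1
stirling2 zero    (suc k) = 0
stirling2 (suc n) zero    = 0
stirling2 (suc n) (suc k) = suc k ℕ.* stirling2 n (suc k) ℕ.+ stirling2 n k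

rising : ℕ → ℕ → ℕ
rising x zero    = 1
rising x (suc k) = rising x k ℕ.* (x ℕ.+ k)

sumTo : ℕ → (ℕ → ℤ) → ℤ
sumTo zero    f = f 0
sumTo (suc n) f = sumTo n f + f (suc n)

w : ℕ → ℕ → ℤ → ℤ
w n r y = sumTo n (λ k → + (stirling2 n k ℕ.* rising r k) * (y ^ k))

{-# OPTIONS --safe #-}
-- For n ≥ 1 the k = 0 term of w_n^{(r)}(y) vanishes because S(n,0) = 0, and every
-- other term contains the factor (r)_k, which is a multiple of r. Hence r divides
-- w_n^{(r)}(y), and so does every divisor q of r.
module Submission where

open import Defs
open import Data.Nat using (ℕ; _≥_; _>_; zero; suc)
import Data.Nat as ℕ
open import Data.Nat.Properties using (+-identityʳ)
open import Data.Nat.Primality using (Prime)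
import Data.Nat.Divisibility as ℕD
open import Data.Integer using (ℤ; +_; _*_; _^_)
open import Data.Integer.Divisibility using (_∣_)
open import Data.Integer.Divisibility.Signed as Signed using (∣ᵤ⇒∣; ∣⇒∣ᵤ; ∣m∣n⇒∣m+n; ∣m⇒∣m*n)
open import Relation.Nullary using (¬_)
open import Relation.Binary.PropositionalEquality using (sym)

∣rising : ∀ x k → x ℕD.∣ rising x (suc k)
∣rising x zero    = ℕD.∣n⇒∣m*n 1 (ℕD.∣-reflexive (sym (+-identityʳ x)))
∣rising x (suc k) = ℕD.∣m⇒∣m*n (x ℕ.+ suc k) (∣rising x k)

∣stirling2-suc*rising : ∀ n x k → x ℕD.∣ stirling2 (suc n) k ℕ.* rising x k
∣stirling2-suc*rising n x zero    = x ℕD.∣0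
∣stirling2-suc*rising n x (suc k) = ℕD.∣n⇒∣m*n (stirling2 (suc n) (suc k)) (∣rising x k)

∣-sumTo : ∀ {d : ℤ} {f : ℕ → ℤ} → (∀ k → d Signed.∣ f k) → ∀ n → d Signed.∣ sumTo n f
∣-sumTo d∣f zero    = d∣f 0
∣-sumTo d∣f (suc n) = ∣m∣n⇒∣m+n (∣-sumTo d∣f n) (d∣f (suc n))

∣w-suc : ∀ n r y → + r ∣ w (suc n) r y
∣w-suc n r y = ∣⇒∣ᵤ (∣-sumTo r∣term (suc n))
  where
  r∣term : ∀ k → + r Signed.∣ + (stirling2 (suc n) k ℕ.* rising r k) * y ^ k
  r∣term k = ∣m⇒∣m*n (y ^ k) (∣ᵤ⇒∣ {i = + _} (∣stirling2-suc*rising n r k))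

theorem4p4 : (q : ℕ) → Prime q → (y : ℤ) → ¬ (+ q ∣ y) →
    (n r : ℕ) → n ≥ 1 → r > 0 → q ℕD.∣ r → + q ∣ w n r y
theorem4p4 q _ y _ (suc n) r _ _ q∣r = ℕD.∣-trans q∣r (∣w-suc n r y)
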